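{- Let $T$ be a tree on $n \ge 2$ vertices. Then $\textrm{RED:LD}(T) = n$ if and only if every vertex of $T$ is a leaf or a support vertex.
   Context: A leaf is a vertex of degree 1; a support vertex is a vertex adjacent to a leaf. $N(v)$ denotes the open neighborhood of $v$. A set $S \subseteq V(G)$ is a locating-dominating (LD) set if for all $u,v \in V(G)-S$: $N(v)\cap S \neq \varnothing$, and if $u \ne v$ then $N(v) \cap S \neq N(u) \cap S$. A RED:LD set is an LD set $S$ such that $S-\{v\}$ is an LD set for every $v \in S$. $\textrm{RED:LD}(G)$ is the minimum cardinality of a RED:LD set of $G$. -}

module Defs where

open import Data.Nat using (ℕ; suc; _≤_)
open import Data.Fin using (Fin)
open import Data.Fin.Subset using (Subset; _∈_; _∉_; _-_; ∣_∣)
open import Data.List using (List; []; _∷_; length)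
open import Data.List.Relation.Unary.Unique.Propositional using (Unique)
open import Data.Product using (Σ; ∃; ∃-syntax; _×_)
open import Data.Empty using (⊥)
open import Relation.Nullary using (¬_; Dec)
open import Relation.Binary.PropositionalEquality using (_≡_; _≢_)
open import Function.Bundles using (_⇔_)

record Graph (n : ℕ) : Set₁ where
  field
    Adj    : Fin n → Fin n → Set
    adj?   : ∀ u v → Dec (Adj u v)
    sym    : ∀ {u v} → Adj u v → Adj v u
    irrefl : ∀ {u} → ¬ Adj u u

open Graph public

module _ {n : ℕ} (G : Graph n) where

  data Walk : Fin n → Fin n → Set where
    here : ∀ {u} → Walk u u
    step : ∀ {u w v} → Adj G u w → Walk w v → Walk u v

  Connected : Set
  Connected = ∀ u v → Walk u v

  ClosedChain : Fin n → Fin n → List (Fin n) → Set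
  ClosedChain first x []       = Adj G x first
  ClosedChain first x (y ∷ ys) = Adj G x y × ClosedChain first y ys

  Cycle : Set
  Cycle = Σ (Fin n) λ x → Σ (List (Fin n)) λ xs →
            (2 ≤ length xs) × Unique (x ∷ xs) × ClosedChain x x xs

  Acyclic : Set
  Acyclic = ¬ Cycle

  IsTree : Set
  IsTree = Connected × Acyclic

  IsLeaf : Fin n → Set
  IsLeaf v = ∃[ u ] (Adj G v u × (∀ w → Adj G v w → w ≡ u))

  IsSupport : Fin n → Set
  IsSupport v = ∃[ u ] (Adj G v u × IsLeaf u)

  IsLD : Subset n → Set
  IsLD S =
    (∀ v → v ∉ S → ∃[ w ] (w ∈ S × Adj G v w)) ×
    (∀ u v → u ∉ S → v ∉ S → u ≢ v →
       ¬ (∀ w → w ∈ S → (Adj G v w ⇔ Adj G u w)))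

  IsREDLD : Subset n → Set
  IsREDLD S = IsLD S × (∀ v → v ∈ S → IsLD (S - v))

  REDLDNumber : ℕ → Set
  REDLDNumber k =
    (∃[ S ] (IsREDLD S × ∣ S ∣ ≡ k)) × (∀ S → IsREDLD S → k ≤ ∣ S ∣)

-- Every leaf and every support vertex lies in every RED:LD set: if a leaf or
-- its support vertex were missing, removing one vertex would leave the leaf
-- undominated. So if all vertices are leaves or supports, V is the only RED:LD
-- set. Conversely, if x is neither, then V − x is already RED:LD: after also
-- removing any v, both x and v are still dominated (x has two neighbours, and a
-- neighbour v of x is no leaf), and N(x) − v = N(v) − x would produce a
-- triangle x v c (if x ~ v) or a square x a v b (if x ≁ v) in the tree.
module Submission where

open import Defs renaming (sym to Adj-sym)
open import Data.Nat using (ℕ; _≤_; s≤s; z≤n)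
open import Data.Nat.Properties using (<-irrefl; module ≤-Reasoning)
open import Data.Fin using (Fin; zero; _≟_; punchIn)
open import Data.Fin.Properties using (any?; all?; ¬∀⟶∃¬; punchInᵢ≢i)
open import Data.Fin.Subset using (Subset; _∈_; _∉_; _─_; _-_; ∣_∣; ⊤; ⁅_⁆; outside)
open import Data.Fin.Subset.Properties
  using (_∈?_; ∈⊤; ∣⊤∣≡n; p⊆q⇒∣p∣≤∣q∣; x∈p⇒∣p-x∣<∣p∣; x∈p∧x≢y⇒x∈p-y; p─q⊆p; x∈⁅x⁆)
open import Data.Vec using (_∷_)
open import Data.Vec.Base using (here; there)
open import Data.List using ([]; _∷_)
open import Data.List.Relation.Unary.All using ([]; _∷_)
open import Data.List.Relation.Unary.AllPairs using ([]; _∷_)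
open import Data.Product using (∃-syntax; _×_; _,_; proj₁)
open import Data.Sum using (_⊎_; inj₁; inj₂)
open import Data.Empty using (⊥; ⊥-elim)
open import Relation.Nullary using (¬_; Dec; yes; no)
open import Relation.Nullary.Decidable using (_×-dec_; _⊎-dec_; _→-dec_)
open import Relation.Binary.PropositionalEquality using (_≡_; _≢_; refl; sym; trans; subst)
open import Function.Base using (_∘_)
open import Function.Bundles using (_⇔_; mk⇔; Equivalence)

x∈p─q⇒x∉q : ∀ {n} (p q : Subset n) {x} → x ∈ p ─ q → x ∉ q
x∈p─q⇒x∉q (_ ∷ p) (outside ∷ q) here      ()
x∈p─q⇒x∉q (_ ∷ p) (_       ∷ q) (there x∈) (there x∈q) = x∈p─q⇒x∉q p q x∈ x∈q

x∈p-y⇒x∈p : ∀ {n} {p : Subset n} {x y} → x ∈ p - y → x ∈ p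
x∈p-y⇒x∈p {p = p} {y = y} = p─q⊆p p ⁅ y ⁆

x∈p-y⇒x≢y : ∀ {n} {p : Subset n} {x y} → x ∈ p - y → x ≢ y
x∈p-y⇒x≢y {p = p} {y = y} x∈ refl = x∈p─q⇒x∉q p ⁅ y ⁆ x∈ (x∈⁅x⁆ y)

x∉⊤-y⇒x≡y : ∀ {n} {x y : Fin n} → x ∉ ⊤ - y → x ≡ y
x∉⊤-y⇒x≡y {x = x} {y} x∉ with x ≟ y
... | yes x≡y = x≡y
... | no  x≢y = ⊥-elim (x∉ (x∈p∧x≢y⇒x∈p-y ∈⊤ x≢y))

x∉⊤-y-z⇒x≡y⊎x≡z : ∀ {n} {x y z : Fin n} → x ∉ ⊤ - y - z → x ≡ y ⊎ x ≡ z
x∉⊤-y-z⇒x≡y⊎x≡z {x = x} {y} {z} x∉ with x ≟ z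
... | yes x≡z = inj₂ x≡z
... | no  x≢z = inj₁ (x∉⊤-y⇒x≡y (λ x∈ → x∉ (x∈p∧x≢y⇒x∈p-y x∈ x≢z)))

x∈⊤-y-z : ∀ {n} {x y z : Fin n} → x ≢ y → x ≢ z → x ∈ ⊤ - y - z
x∈⊤-y-z x≢y x≢z = x∈p∧x≢y⇒x∈p-y (x∈p∧x≢y⇒x∈p-y ∈⊤ x≢y) x≢z

module _ {n : ℕ} (G : Graph n) where

  NoIsolated : Set
  NoIsolated = ∀ v → ∃[ w ] Adj G v w

  Adj⇒≢ : ∀ {u w} → Adj G u w → u ≢ w
  Adj⇒≢ u~w refl = irrefl G u~w

  connected⇒noIsolated : 2 ≤ n → Connected G → NoIsolated
  connected⇒noIsolated (s≤s (s≤s _)) conn v =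
    first-step (conn v (punchIn v zero)) (λ eq → punchInᵢ≢i v zero (sym eq))
    where
    first-step : ∀ {u w} → Walk G u w → u ≢ w → ∃[ y ] Adj G u y
    first-step here         u≢u = ⊥-elim (u≢u refl)
    first-step (step u~y _) _   = _ , u~y

  ¬leaf⇒another-neighbour : ∀ {v u} → ¬ IsLeaf G v → Adj G v u → ∃[ w ] (Adj G v w × w ≢ u)
  ¬leaf⇒another-neighbour {v} {u} ¬leaf v~u
    with ¬∀⟶∃¬ n (λ w → Adj G v w → w ≡ u) (λ w → adj? G v w →-dec (w ≟ u))
                 (λ unique → ¬leaf (u , v~u , unique))
  ... | w , ¬[v~w⇒w≡u] with adj? G v w
  ...   | yes v~w = w , v~w , λ w≡u → ¬[v~w⇒w≡u] (λ _ → w≡u)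
  ...   | no  v≁w = ⊥-elim (¬[v~w⇒w≡u] (λ v~w → ⊥-elim (v≁w v~w)))

  leaf? : ∀ v → Dec (IsLeaf G v)
  leaf? v = any? (λ u → adj? G v u ×-dec all? (λ w → adj? G v w →-dec (w ≟ u)))

  support? : ∀ v → Dec (IsSupport G v)
  support? v = any? (λ u → adj? G v u ×-dec leaf? u)

  leaf∈REDLD : ∀ {S v} → IsREDLD G S → IsLeaf G v → v ∈ S
  leaf∈REDLD {S} {v} ((dominating , _) , redundant) (u , v~u , unique) with v ∈? S
  ... | yes v∈S = v∈S
  ... | no  v∉S =
    let w , w∈S , v~w = dominating v v∉S
        u∈S = subst (_∈ S) (unique w v~w) w∈S
        w′ , w′∈S-u , v~w′ = proj₁ (redundant u u∈S) v (λ v∈S-u → v∉S (x∈p-y⇒x∈p v∈S-u))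
    in ⊥-elim (x∈p-y⇒x≢y w′∈S-u (unique w′ v~w′))

  support∈REDLD : ∀ {S v} → IsREDLD G S → IsSupport G v → v ∈ S
  support∈REDLD {S} {v} ((dominating , _) , redundant) (ℓ , v~ℓ , (u , ℓ~u , unique))
    with ℓ ∈? S
  ... | no  ℓ∉S = let w , w∈S , ℓ~w = dominating ℓ ℓ∉S in
    subst (_∈ S) (trans (unique w ℓ~w) (sym (unique v (Adj-sym G v~ℓ)))) w∈S
  ... | yes ℓ∈S = let w , w∈S-ℓ , ℓ~w = proj₁ (redundant ℓ ℓ∈S) ℓ (λ ℓ∈S-ℓ → x∈p-y⇒x≢y ℓ∈S-ℓ refl) in
    subst (_∈ S) (trans (unique w ℓ~w) (sym (unique v (Adj-sym G v~ℓ)))) (x∈p-y⇒x∈p w∈S-ℓ)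

  ⊤-isLD : IsLD G ⊤
  ⊤-isLD = (λ _ v∉⊤ → ⊥-elim (v∉⊤ ∈⊤)) , (λ _ _ u∉⊤ _ _ _ → u∉⊤ ∈⊤)

  ⊤-x-isLD : ∀ {x} → ∃[ w ] Adj G x w → IsLD G (⊤ - x)
  ⊤-x-isLD {x} (w , x~w) = dominating , separating
    where
    dominating : ∀ v → v ∉ ⊤ - x → ∃[ y ] (y ∈ ⊤ - x × Adj G v y)
    dominating v v∉ with x∉⊤-y⇒x≡y v∉
    ... | refl = w , x∈p∧x≢y⇒x∈p-y ∈⊤ (λ w≡x → Adj⇒≢ x~w (sym w≡x)) , x~w
    separating : ∀ u v → u ∉ ⊤ - x → v ∉ ⊤ - x → u ≢ v → ¬ (∀ y → y ∈ ⊤ - x → (Adj G v y ⇔ Adj G u y))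
    separating u v u∉ v∉ u≢v _ = u≢v (trans (x∉⊤-y⇒x≡y u∉) (sym (x∉⊤-y⇒x≡y v∉)))

  ⊤-isREDLD : NoIsolated → IsREDLD G ⊤
  ⊤-isREDLD noIsolated = ⊤-isLD , λ x _ → ⊤-x-isLD (noIsolated x)

  leaf⊎support⇒REDLDNumber : NoIsolated → (∀ v → IsLeaf G v ⊎ IsSupport G v) → REDLDNumber G n
  leaf⊎support⇒REDLDNumber noIsolated leaf⊎support =
    (⊤ , ⊤-isREDLD noIsolated , ∣⊤∣≡n n) ,
    λ S S-REDLD → subst (_≤ ∣ S ∣) (∣⊤∣≡n n) (p⊆q⇒∣p∣≤∣q∣ {p = ⊤} (λ {v} _ → ∈S S-REDLD v))
    where
    ∈S : ∀ {S} → IsREDLD G S → ∀ v → v ∈ S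
    ∈S S-REDLD v with leaf⊎support v
    ... | inj₁ leaf    = leaf∈REDLD S-REDLD leaf
    ... | inj₂ support = support∈REDLD S-REDLD support

  neighbour∈⊤-x-v : ∀ {x v w} → Adj G x w → w ≢ v → w ∈ ⊤ - x - v
  neighbour∈⊤-x-v x~w = x∈⊤-y-z (λ w≡x → Adj⇒≢ x~w (sym w≡x))

  acyclic⇒no-triangle : Acyclic G → ∀ {x y z} → Adj G x y → Adj G y z → Adj G z x → ⊥
  acyclic⇒no-triangle acyclic x~y y~z z~x =
    acyclic (_ , _ ∷ _ ∷ [] , s≤s (s≤s z≤n)
            , ((Adj⇒≢ x~y ∷ (λ x≡z → Adj⇒≢ z~x (sym x≡z)) ∷ []) ∷ (Adj⇒≢ y~z ∷ []) ∷ [] ∷ [])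
            , x~y , y~z , z~x)

  acyclic⇒no-square : Acyclic G → ∀ {x a v b} → x ≢ v → a ≢ b →
                      Adj G x a → Adj G a v → Adj G v b → Adj G b x → ⊥
  acyclic⇒no-square acyclic x≢v a≢b x~a a~v v~b b~x =
    acyclic (_ , _ ∷ _ ∷ _ ∷ [] , s≤s (s≤s z≤n)
            , ((Adj⇒≢ x~a ∷ x≢v ∷ (λ x≡b → Adj⇒≢ b~x (sym x≡b)) ∷ [])
               ∷ (Adj⇒≢ a~v ∷ a≢b ∷ []) ∷ (Adj⇒≢ v~b ∷ []) ∷ [] ∷ [])
            , x~a , a~v , v~b , b~x)

  ¬leaf⇒neighbour-avoiding : NoIsolated → ∀ {x} → ¬ IsLeaf G x → ∀ v → ∃[ c ] (Adj G x c × c ≢ v)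
  ¬leaf⇒neighbour-avoiding noIsolated {x} ¬leaf v with noIsolated x
  ... | a , x~a with a ≟ v
  ...   | no  a≢v  = a , x~a , a≢v
  ...   | yes refl = ¬leaf⇒another-neighbour ¬leaf x~a

  ¬support⇒neighbour-avoiding : NoIsolated → ∀ {x} → ¬ IsSupport G x → ∀ v → ∃[ y ] (Adj G v y × y ≢ x)
  ¬support⇒neighbour-avoiding noIsolated {x} ¬support v with noIsolated v
  ... | y , v~y with y ≟ x
  ...   | no  y≢x  = y , v~y , y≢x
  ...   | yes refl = ¬leaf⇒another-neighbour (λ v-leaf → ¬support (v , Adj-sym G v~y , v-leaf)) v~y

  ¬leaf⇒neighbourhoods-differ : NoIsolated → Acyclic G → ∀ {x v} → ¬ IsLeaf G x → v ≢ x →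
                                ¬ (∀ w → w ∈ ⊤ - x - v → Adj G x w → Adj G v w)
  ¬leaf⇒neighbourhoods-differ noIsolated acyclic {x} {v} ¬leaf v≢x N[x]⊆N[v] with adj? G x v
  ... | yes x~v =
    let c , x~c , c≢v = ¬leaf⇒neighbour-avoiding noIsolated ¬leaf v
    in acyclic⇒no-triangle acyclic x~v (N[x]⊆N[v] c (neighbour∈⊤-x-v x~c c≢v) x~c) (Adj-sym G x~c)
  ... | no  x≁v =
    let a , x~a       = noIsolated x
        b , x~b , b≢a = ¬leaf⇒neighbour-avoiding noIsolated ¬leaf a
        ≢v : ∀ {w} → Adj G x w → w ≢ v
        ≢v x~w w≡v = x≁v (subst (Adj G x) w≡v x~w)
    in acyclic⇒no-square acyclic (λ x≡v → v≢x (sym x≡v)) (λ a≡b → b≢a (sym a≡b)) x~a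
         (Adj-sym G (N[x]⊆N[v] a (neighbour∈⊤-x-v x~a (≢v x~a)) x~a))
         (N[x]⊆N[v] b (neighbour∈⊤-x-v x~b (≢v x~b)) x~b) (Adj-sym G x~b)

  module _ (noIsolated : NoIsolated) (acyclic : Acyclic G) {x} (¬leaf : ¬ IsLeaf G x) (¬support : ¬ IsSupport G x) where

    ⊤-x-v-isLD : ∀ {v} → v ≢ x → IsLD G (⊤ - x - v)
    ⊤-x-v-isLD {v} v≢x = dominating , separating
      where
      dominating : ∀ w → w ∉ ⊤ - x - v → ∃[ y ] (y ∈ ⊤ - x - v × Adj G w y)
      dominating w w∉ with x∉⊤-y-z⇒x≡y⊎x≡z w∉
      ... | inj₁ refl = let c , x~c , c≢v = ¬leaf⇒neighbour-avoiding noIsolated ¬leaf v in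
        c , neighbour∈⊤-x-v x~c c≢v , x~c
      ... | inj₂ refl = let y , v~y , y≢x = ¬support⇒neighbour-avoiding noIsolated ¬support v in
        y , x∈⊤-y-z y≢x (λ y≡v → Adj⇒≢ v~y (sym y≡v)) , v~y

      differ : ¬ (∀ w → w ∈ ⊤ - x - v → Adj G x w → Adj G v w)
      differ = ¬leaf⇒neighbourhoods-differ noIsolated acyclic ¬leaf v≢x

      separating : ∀ u w → u ∉ ⊤ - x - v → w ∉ ⊤ - x - v → u ≢ w →
                   ¬ (∀ y → y ∈ ⊤ - x - v → (Adj G w y ⇔ Adj G u y))
      separating u w u∉ w∉ u≢w same with x∉⊤-y-z⇒x≡y⊎x≡z u∉ | x∉⊤-y-z⇒x≡y⊎x≡z w∉
      ... | inj₁ refl | inj₁ refl = u≢w refl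
      ... | inj₂ refl | inj₂ refl = u≢w refl
      ... | inj₁ refl | inj₂ refl = differ (λ y y∈ → Equivalence.from (same y y∈))
      ... | inj₂ refl | inj₁ refl = differ (λ y y∈ → Equivalence.to (same y y∈))

    ⊤-x-isREDLD : IsREDLD G (⊤ - x)
    ⊤-x-isREDLD = ⊤-x-isLD (noIsolated x) , λ v v∈ → ⊤-x-v-isLD (x∈p-y⇒x≢y v∈)

  REDLDNumber⇒leaf⊎support : NoIsolated → Acyclic G → REDLDNumber G n → ∀ v → IsLeaf G v ⊎ IsSupport G v
  REDLDNumber⇒leaf⊎support noIsolated acyclic (_ , minimal) v with leaf? v ⊎-dec support? v
  ... | yes leaf⊎support = leaf⊎support
  ... | no  neither      = ⊥-elim (<-irrefl refl (begin-strict
    n               ≤⟨ minimal _ (⊤-x-isREDLD noIsolated acyclic (neither ∘ inj₁) (neither ∘ inj₂)) ⟩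
    ∣ ⊤ - v ∣       <⟨ x∈p⇒∣p-x∣<∣p∣ {p = ⊤ {n}} (∈⊤ {x = v}) ⟩
    ∣ ⊤ {n} ∣       ≡⟨ ∣⊤∣≡n n ⟩
    n               ∎))
    where open ≤-Reasoning

theorem9 : (n : ℕ) → 2 ≤ n → (T : Graph n) → IsTree T →
    (REDLDNumber T n ⇔ (∀ v → IsLeaf T v ⊎ IsSupport T v))
theorem9 n 2≤n T (connected , acyclic) =
  mk⇔ (REDLDNumber⇒leaf⊎support T noIsolated acyclic) (leaf⊎support⇒REDLDNumber T noIsolated)
  where
  noIsolated : NoIsolated T
  noIsolated = connected⇒noIsolated T 2≤n connected
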